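{- For $a\in\{5,6,7\}$ and for every integer $a\ge 10$, $$ n(a,a+5,a+6,a+7)=\begin{cases} \frac{a^2+17 a+84}{14}&\text{if } a\equiv 0\pmod 7,\\ \frac{a^2+17 a+66}{14}&\text{if } a\equiv 1\pmod 7,\\ \frac{a^2+17 a+60}{14}&\text{if } a\equiv 2\pmod 7,\\ \frac{a^2+17 a+52}{14}&\text{if } a\equiv 3\pmod 7,\\ \frac{a^2+17 a+56}{14}&\text{if } a\equiv 4\pmod 7,\\ \frac{a^2+17 a+58}{14}&\text{if } a\equiv 5\pmod 7,\\ \frac{a^2+17 a+72}{14}&\text{if } a\equiv 6\pmod 7. \end{cases} $$
   Context: For positive integers $a_1,\dots,a_m$ with $\gcd(a_1,\dots,a_m)=1$, the Sylvester number $n(a_1,\dots,a_m)$ is the number of positive integers that cannot be written as $x_1a_1+\cdots+x_ma_m$ with nonnegative integers $x_i$. -}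

module Defs where

open import Data.Nat using (ℕ; zero; suc; _+_; _*_; _%_; _<_; _≤_)
open import Data.List using (List; []; _∷_; length; zipWith)
open import Data.Nat.ListAction using (sum)
open import Data.List.Membership.Propositional using (_∈_)
open import Data.List.Relation.Unary.Unique.Propositional using (Unique)
open import Data.Product using (Σ; ∃; _×_; _,_)
open import Function.Bundles using (_⇔_)
open import Relation.Binary.PropositionalEquality using (_≡_)
open import Relation.Nullary using (¬_)

Representable : List ℕ → ℕ → Set
Representable gs n =
  Σ (List ℕ) λ xs → (length xs ≡ length gs) × (sum (zipWith _*_ xs gs) ≡ n)

Gap : List ℕ → ℕ → Set
Gap gs n = (0 < n) × ¬ Representable gs n

-- "the number of gaps is N": there is a duplicate-free list enumerating
-- exactly the gaps, of length N.
SylvesterNumberIs : List ℕ → ℕ → Set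
SylvesterNumberIs gs N =
  Σ (List ℕ) λ l → Unique l × (∀ n → (n ∈ l) ⇔ Gap gs n) × (length l ≡ N)

-- constant term of the numerator a² + 17a + c, by a mod 7
const7 : ℕ → ℕ
const7 0 = 84
const7 1 = 66
const7 2 = 60
const7 3 = 52
const7 4 = 56
const7 5 = 58
const7 _ = 72

-- A representation of n by a, a + 5, a + 6, a + 7 with k generators is n = k·a + t with t a
-- sum of at most k terms from {5, 6, 7}. Hence the least representable number ≡ r (mod a) is
-- D·a + r with D = d + ⌈(d·a + r)/7⌉, where d is least with d·a + r a sum of 5s, 6s and 7s,
-- and by Selmer's formula the number of gaps is the sum of these D over r < a. For a ≥ 10,
-- d is 0 or 1 according as r is or is not such a sum, since a + r ≥ 10 always is. Passing
-- from a to a + 7 then adds seven residue classes with ∑_{i<7} ⌈(a + i)/7⌉ = a + 6 gaps, and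
-- one gap in each of the six classes r ∈ {1, 2, 3, 4, 8, 9}; this matches the growth
-- 14(a + 12) of the numerator, so it remains to compute a = 5, 6, 7 and a = 10, …, 16.

module Submission where

open import Defs
open import Data.List using (List; []; _∷_; length; map; downFrom; concatMap)
open import Data.List.Membership.Propositional using (_∈_; find; lose)
open import Data.List.Membership.Propositional.Properties
  using (∈-map⁺; ∈-map⁻; ∈-concatMap⁺; ∈-concatMap⁻; ∈-downFrom⁺; ∈-downFrom⁻)
open import Data.List.Properties using (length-++; length-map; length-downFrom; map-cong)
open import Data.List.Relation.Binary.Disjoint.Propositional using (Disjoint)
open import Data.List.Relation.Unary.All as All using (All)
import Data.List.Relation.Unary.All.Properties as All
import Data.List.Relation.Unary.AllPairs.Properties as AllPairs
open import Data.List.Relation.Unary.Unique.Propositional using (Unique)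
import Data.List.Relation.Unary.Unique.Propositional.Properties as Unique
open import Data.Nat using (ℕ; zero; suc; _+_; _*_; _/_; _%_; _≤_; _<_; _≤?_; NonZero)
open import Data.Nat.DivMod
  using (m≡m%n+[m/n]*n; m%n<n; m<n⇒m%n≡m; %-remove-+ˡ; m<n*o⇒m/o<n; m/n≡1+[m∸n]/n; /-monoˡ-≤)
open import Data.Nat.Divisibility using (n∣m*n; ∣-refl)
open import Data.Nat.ListAction using (sum)
open import Data.Nat.Properties
open import Algebra.Properties.CommutativeSemigroup +-commutativeSemigroup using (interchange)
open import Data.Nat.Tactic.RingSolver using (solve-∀; solve)
open import Data.Product using (∃; _×_; _,_; proj₁)
open import Data.Sum using (_⊎_; inj₁; inj₂)
open import Function using (id)
open import Function.Bundles using (mk⇔)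
open import Relation.Binary.PropositionalEquality
  using (_≡_; refl; sym; trans; cong; cong₂; subst; module ≡-Reasoning)
open import Relation.Nullary using (¬_; Dec; contradiction)
open import Relation.Nullary.Decidable using (yes; no; ¬?; _×-dec_; from-yes; True; toWitness)
open import Relation.Unary using (Decidable)

∑< : ℕ → (ℕ → ℕ) → ℕ
∑< n f = sum (map f (downFrom n))

syntax ∑< n (λ r → e) = ∑[ r < n ] e

∑-+ : ∀ n (f g : ℕ → ℕ) → ∑[ r < n ] (f r + g r) ≡ ∑[ r < n ] f r + ∑[ r < n ] g r
∑-+ zero f g = refl
∑-+ (suc n) f g = trans (cong (f n + g n +_) (∑-+ n f g)) (interchange (f n) (g n) _ _)

∑-cong : ∀ n {f g : ℕ → ℕ} → (∀ r → f r ≡ g r) → ∑[ r < n ] f r ≡ ∑[ r < n ] g r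
∑-cong n f≗g = cong sum (map-cong f≗g (downFrom n))

∑-split : ∀ m n (f : ℕ → ℕ) → ∑[ r < n + m ] f r ≡ ∑[ i < n ] f (i + m) + ∑[ r < m ] f r
∑-split m zero f = refl
∑-split m (suc n) f = trans (cong (f (n + m) +_) (∑-split m n f)) (sym (+-assoc (f (n + m)) _ _))

∑-shift : ∀ n (f : ℕ → ℕ) → ∑[ i < n ] f (suc i) + f 0 ≡ f n + ∑[ i < n ] f i
∑-shift zero f = sym (+-identityʳ (f 0))
∑-shift (suc n) f = trans (+-assoc (f (suc n)) _ (f 0)) (cong (f (suc n) +_) (∑-shift n f))

⌈_/7⌉ : ℕ → ℕ
⌈ n /7⌉ = (6 + n) / 7

⌈7+n/7⌉ : ∀ n → ⌈ 7 + n /7⌉ ≡ suc ⌈ n /7⌉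
⌈7+n/7⌉ n = m/n≡1+[m∸n]/n {6 + (7 + n)} (m≤m+n 7 (6 + n))

n≤7*⌈n/7⌉ : ∀ n → n ≤ 7 * ⌈ n /7⌉
n≤7*⌈n/7⌉ n = +-cancelˡ-≤ 6 n (7 * ⌈ n /7⌉) (begin
  6 + n                          ≡⟨ m≡m%n+[m/n]*n (6 + n) 7 ⟩
  (6 + n) % 7 + ⌈ n /7⌉ * 7      ≤⟨ +-monoˡ-≤ _ (≤-pred (m%n<n (6 + n) 7)) ⟩
  6 + ⌈ n /7⌉ * 7                ≡⟨ cong (6 +_) (*-comm ⌈ n /7⌉ 7) ⟩
  6 + 7 * ⌈ n /7⌉                ∎)
  where open ≤-Reasoning

⌈n/7⌉-least : ∀ {n m} → n ≤ 7 * m → ⌈ n /7⌉ ≤ m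
⌈n/7⌉-least {n} {m} n≤7m = ≤-pred (m<n*o⇒m/o<n (begin-strict
  6 + n        ≤⟨ +-monoʳ-≤ 6 n≤7m ⟩
  6 + 7 * m    <⟨ ≤-refl ⟩
  7 + 7 * m    ≡⟨ solve (m ∷ []) ⟩
  suc m * 7    ∎))
  where open ≤-Reasoning

⌈/7⌉-mono-≤ : ∀ {m n} → m ≤ n → ⌈ m /7⌉ ≤ ⌈ n /7⌉
⌈/7⌉-mono-≤ m≤n = /-monoˡ-≤ 7 (+-monoʳ-≤ 6 m≤n)

∑⌈/7⌉-7 : ∀ x → ∑[ i < 7 ] ⌈ i + x /7⌉ ≡ 6 + x
∑⌈/7⌉-7 zero = refl
∑⌈/7⌉-7 (suc x) = +-cancelʳ-≡ ⌈ x /7⌉ _ _ (begin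
  ∑[ i < 7 ] ⌈ i + suc x /7⌉ + ⌈ x /7⌉   ≡⟨ ∑-shift 7 (λ i → ⌈ i + x /7⌉) ⟩
  ⌈ 7 + x /7⌉ + ∑[ i < 7 ] ⌈ i + x /7⌉   ≡⟨ cong₂ _+_ (⌈7+n/7⌉ x) (∑⌈/7⌉-7 x) ⟩
  suc ⌈ x /7⌉ + (6 + x)                   ≡⟨ cong suc (+-comm ⌈ x /7⌉ (6 + x)) ⟩
  7 + x + ⌈ x /7⌉                         ∎)
  where open ≡-Reasoning

-- t is a sum of 5s, 6s and 7s: m such summands reach exactly the t with 5m ≤ t ≤ 7m,
-- so it suffices to try the fewest possible, m = ⌈t/7⌉.
Sum567 : ℕ → Set
Sum567 t = 5 * ⌈ t /7⌉ ≤ t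

sum567? : Decidable Sum567
sum567? t = 5 * ⌈ t /7⌉ ≤? t

sum567-10+ : ∀ y → Sum567 (10 + y)
sum567-10+ 0 = from-yes (sum567? 10)
sum567-10+ 1 = from-yes (sum567? 11)
sum567-10+ 2 = from-yes (sum567? 12)
sum567-10+ 3 = from-yes (sum567? 13)
sum567-10+ 4 = from-yes (sum567? 14)
sum567-10+ 5 = from-yes (sum567? 15)
sum567-10+ 6 = from-yes (sum567? 16)
sum567-10+ (suc (suc (suc (suc (suc (suc (suc y))))))) = begin
  5 * ⌈ 7 + (10 + y) /7⌉     ≡⟨ cong (5 *_) (⌈7+n/7⌉ (10 + y)) ⟩
  5 * suc ⌈ 10 + y /7⌉       ≡⟨ *-suc 5 _ ⟩
  5 + 5 * ⌈ 10 + y /7⌉       ≤⟨ +-mono-≤ (m≤m+n 5 2) (sum567-10+ y) ⟩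
  7 + (10 + y)               ∎
  where open ≤-Reasoning

sum567-≥10 : ∀ {t} → 10 ≤ t → Sum567 t
sum567-≥10 10≤t with y , refl ← m≤n⇒∃[o]m+o≡n 10≤t = sum567-10+ y

sum567-intro : ∀ {m t} → 5 * m ≤ t → t ≤ 7 * m → Sum567 t
sum567-intro {m} 5m≤t t≤7m = ≤-trans (*-monoʳ-≤ 5 (⌈n/7⌉-least {m = m} t≤7m)) 5m≤t

representable-zero : ∀ gs → Representable gs 0
representable-zero [] = [] , refl , refl
representable-zero (g ∷ gs) with xs , length-xs , sum≡0 ← representable-zero gs =
  0 ∷ xs , cong suc length-xs , sum≡0

-- Selmer's formula n = ∑ (w_r − r)/a, where w_r = D r · a + r is the least representable
-- number ≡ r mod a.
module Selmer (gs : List ℕ) (a : ℕ) {{_ : NonZero a}} (D : ℕ → ℕ)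
  (gap : ∀ {q r} → r < a → q < D r → ¬ Representable gs (q * a + r))
  (nongap : ∀ {q r} → r < a → D r ≤ q → Representable gs (q * a + r)) where

  column : ℕ → List ℕ
  column r = map (λ q → q * a + r) (downFrom (D r))

  gaps : List ℕ
  gaps = concatMap column (downFrom a)

  residue : ∀ q {r} → r < a → (q * a + r) % a ≡ r
  residue q r<a = trans (%-remove-+ˡ _ (n∣m*n q)) (m<n⇒m%n≡m r<a)

  ∈-column⁻ : ∀ {n r} → n ∈ column r → ∃ λ q → q < D r × n ≡ q * a + r
  ∈-column⁻ n∈ with q , q∈ , refl ← ∈-map⁻ _ n∈ = q , ∈-downFrom⁻ q∈ , refl

  column-unique : ∀ r → Unique (column r)
  column-unique r = Unique.map⁺ (λ {q} {q′} eq → *-cancelʳ-≡ q q′ a (+-cancelʳ-≡ r _ _ eq))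
                                (Unique.downFrom⁺ (D r))

  columns-disjoint : ∀ {r r′} → r′ < r → r < a → Disjoint (column r) (column r′)
  columns-disjoint {r} {r′} r′<r r<a (n∈r , n∈r′)
    with q , _ , refl ← ∈-column⁻ n∈r | q′ , _ , eq ← ∈-column⁻ n∈r′ =
    <-irrefl (begin
      r′                  ≡⟨ residue q′ (<-trans r′<r r<a) ⟨
      (q′ * a + r′) % a   ≡⟨ cong (_% a) eq ⟨
      (q * a + r) % a     ≡⟨ residue q r<a ⟩
      r                   ∎) r′<r
    where open ≡-Reasoning

  gaps-unique : Unique gaps
  gaps-unique = Unique.concat⁺
    (All.map⁺ (All.applyDownFrom⁺₂ id a column-unique))
    (AllPairs.map⁺ (AllPairs.applyDownFrom⁺₁ id a columns-disjoint))

  length-gaps : ∀ rs → length (concatMap column rs) ≡ sum (map D rs)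
  length-gaps [] = refl
  length-gaps (r ∷ rs) = trans (length-++ (column r))
    (cong₂ _+_ (trans (length-map _ (downFrom (D r))) (length-downFrom (D r))) (length-gaps rs))

  ∈-gaps⇒gap : ∀ {n} → n ∈ gaps → Gap gs n
  ∈-gaps⇒gap n∈ with r , r∈ , n∈r ← find (∈-concatMap⁻ column {xs = downFrom a} n∈)
                 with q , q<D , refl ← ∈-column⁻ n∈r
    = n≢0⇒n>0 (λ n≡0 → ¬rep (subst (Representable gs) (sym n≡0) (representable-zero gs))) , ¬rep
    where
    ¬rep = gap (∈-downFrom⁻ r∈) q<D

  gap⇒∈-gaps : ∀ {n} → Gap gs n → n ∈ gaps
  gap⇒∈-gaps {n} (_ , ¬rep) = subst (_∈ gaps) (sym n≡q*a+r)
    (∈-concatMap⁺ column (lose (∈-downFrom⁺ r<a) (∈-map⁺ _ (∈-downFrom⁺ q<D))))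
    where
    q = n / a
    r = n % a
    r<a = m%n<n n a
    n≡q*a+r : n ≡ q * a + r
    n≡q*a+r = trans (m≡m%n+[m/n]*n n a) (+-comm r (q * a))
    q<D : q < D r
    q<D = ≰⇒> (λ D≤q → ¬rep (subst (Representable gs) (sym n≡q*a+r) (nongap r<a D≤q)))

  sylvesterNumberIs : SylvesterNumberIs gs (∑[ r < a ] D r)
  sylvesterNumberIs = gaps , gaps-unique , (λ n → mk⇔ ∈-gaps⇒gap gap⇒∈-gaps) , length-gaps (downFrom a)

generators : ℕ → List ℕ
generators a = a ∷ (a + 5) ∷ (a + 6) ∷ (a + 7) ∷ []

record Rep (a n : ℕ) : Set where
  constructor rep
  field
    k t     : ℕ
    sum567  : Sum567 t
    ⌈t/7⌉≤k : ⌈ t /7⌉ ≤ k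
    k*a+t≡n : k * a + t ≡ n

generators-combination : ∀ a x₀ x₁ x₂ x₃ →
  x₀ * a + (x₁ * (a + 5) + (x₂ * (a + 6) + (x₃ * (a + 7) + 0)))
    ≡ (x₁ + x₂ + x₃ + x₀) * a + (5 * (x₁ + x₂ + x₃) + (x₂ + 2 * x₃))
generators-combination = solve-∀

excess-split : ∀ m e → e ≤ 2 * m →
  ∃ λ x₁ → ∃ λ x₂ → ∃ λ x₃ → x₁ + x₂ + x₃ ≡ m × x₂ + 2 * x₃ ≡ e
excess-split m zero _ = m , 0 , 0 , solve (m ∷ []) , refl
excess-split (suc m) (suc zero) _ = m , 1 , 0 , solve (m ∷ []) , refl
excess-split (suc m) (suc (suc e)) e+2≤2m+2
  with x₁ , x₂ , x₃ , p , q ← excess-split m e (≤-pred (≤-pred (subst (suc (suc e) ≤_) (*-suc 2 m) e+2≤2m+2)))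
  = x₁ , x₂ , suc x₃ , trans (+-suc (x₁ + x₂) x₃) (cong suc p)
  , (begin
       x₂ + 2 * suc x₃     ≡⟨ solve (x₂ ∷ x₃ ∷ []) ⟩
       2 + (x₂ + 2 * x₃)   ≡⟨ cong (2 +_) q ⟩
       suc (suc e)         ∎)
  where open ≡-Reasoning

excess≤ : ∀ {c e t} → 5 * c + e ≡ t → t ≤ 7 * c → e ≤ 2 * c
excess≤ {c} {e} refl t≤7c = +-cancelˡ-≤ (5 * c) e (2 * c) (subst (5 * c + e ≤_) (*-distribʳ-+ c 5 2) t≤7c)

representable⇒Rep : ∀ {a n} → Representable (generators a) n → Rep a n
representable⇒Rep {a} (x₀ ∷ x₁ ∷ x₂ ∷ x₃ ∷ [] , refl , eq) =
  rep (m + x₀) (5 * m + e) (sum567-intro {m} (m≤m+n (5 * m) e) 5m+e≤7m)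
      (≤-trans (⌈n/7⌉-least {m = m} 5m+e≤7m) (m≤m+n m x₀))
      (trans (sym (generators-combination a x₀ x₁ x₂ x₃)) eq)
  where
  m = x₁ + x₂ + x₃
  e = x₂ + 2 * x₃
  e≤2m : e ≤ 2 * m
  e≤2m = begin
    x₂ + 2 * x₃                     ≤⟨ m≤n+m e (2 * x₁ + x₂) ⟩
    2 * x₁ + x₂ + (x₂ + 2 * x₃)     ≡⟨ solve (x₁ ∷ x₂ ∷ x₃ ∷ []) ⟩
    2 * (x₁ + x₂ + x₃)              ∎
    where open ≤-Reasoning
  5m+e≤7m : 5 * m + e ≤ 7 * m
  5m+e≤7m = subst (5 * m + e ≤_) (sym (*-distribʳ-+ m 5 2)) (+-monoʳ-≤ (5 * m) e≤2m)

Rep⇒representable : ∀ {a n} → Rep a n → Representable (generators a) n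
Rep⇒representable {a} (rep k t 5c≤t c≤k refl)
  with x₀ , refl ← m≤n⇒∃[o]m+o≡n c≤k
  with e , 5c+e≡t ← m≤n⇒∃[o]m+o≡n 5c≤t
  with x₁ , x₂ , x₃ , p , q ← excess-split ⌈ t /7⌉ e (excess≤ {⌈ t /7⌉} 5c+e≡t (n≤7*⌈n/7⌉ t))
  = x₀ ∷ x₁ ∷ x₂ ∷ x₃ ∷ [] , refl , (begin
    x₀ * a + (x₁ * (a + 5) + (x₂ * (a + 6) + (x₃ * (a + 7) + 0)))
      ≡⟨ generators-combination a x₀ x₁ x₂ x₃ ⟩
    (x₁ + x₂ + x₃ + x₀) * a + (5 * (x₁ + x₂ + x₃) + (x₂ + 2 * x₃))
      ≡⟨ cong₂ (λ m e → (m + x₀) * a + (5 * m + e)) p q ⟩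
    (c + x₀) * a + (5 * c + e)
      ≡⟨ cong ((c + x₀) * a +_) 5c+e≡t ⟩
    (c + x₀) * a + t ∎)
  where
  open ≡-Reasoning
  c = ⌈ t /7⌉

IsLift : (a r d : ℕ) → Set
IsLift a r d = Sum567 (d * a + r) × All (λ e → ¬ Sum567 (e * a + r)) (downFrom d)

-- For the least lift d of r, depth a r d · a + r is the least representable number ≡ r mod a.
depth : (a r d : ℕ) → ℕ
depth a r d = d + ⌈ d * a + r /7⌉

≤-quotient : ∀ {a k t q r} → r < a → k * a + t ≡ q * a + r → k ≤ q
≤-quotient {a} {k} {t} {q} {r} r<a eq = ≤-pred (*-cancelʳ-< a k (suc q) (begin-strict
  k * a        ≤⟨ m≤m+n (k * a) t ⟩
  k * a + t    ≡⟨ eq ⟩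
  q * a + r    <⟨ +-monoʳ-< (q * a) r<a ⟩
  q * a + a    ≡⟨ +-comm (q * a) a ⟩
  suc q * a    ∎))
  where open ≤-Reasoning

Rep⇒lift : ∀ {a q r} → r < a → Rep a (q * a + r) → ∃ λ d → Sum567 (d * a + r) × depth a r d ≤ q
Rep⇒lift {a} {q} {r} r<a (rep k t sum567 ⌈t/7⌉≤k eq)
  with d , refl ← m≤n⇒∃[o]m+o≡n (≤-quotient {a} {k} {t} {q} r<a eq)
  = d , subst Sum567 t≡d*a+r sum567 , (begin
    d + ⌈ d * a + r /7⌉    ≡⟨ cong (λ t → d + ⌈ t /7⌉) t≡d*a+r ⟨
    d + ⌈ t /7⌉            ≤⟨ +-monoʳ-≤ d ⌈t/7⌉≤k ⟩
    d + k                  ≡⟨ +-comm d k ⟩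
    k + d                  ∎)
  where
  open ≤-Reasoning
  t≡d*a+r : t ≡ d * a + r
  t≡d*a+r = +-cancelˡ-≡ (k * a) t (d * a + r) (begin-equality
    k * a + t              ≡⟨ eq ⟩
    (k + d) * a + r        ≡⟨ cong (_+ r) (*-distribʳ-+ a k d) ⟩
    k * a + d * a + r      ≡⟨ +-assoc (k * a) (d * a) r ⟩
    k * a + (d * a + r)    ∎)

depth≤ : ∀ {a r d q} → IsLift a r d → r < a → Rep a (q * a + r) → depth a r d ≤ q
depth≤ {a} {r} {d} {q} (_ , least) r<a rep-n
  with e , sum567-e , e+⌈⌉≤q ← Rep⇒lift r<a rep-n = begin
    d + ⌈ d * a + r /7⌉    ≤⟨ +-mono-≤ d≤e (⌈/7⌉-mono-≤ (+-monoˡ-≤ r (*-monoˡ-≤ a d≤e))) ⟩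
    e + ⌈ e * a + r /7⌉    ≤⟨ e+⌈⌉≤q ⟩
    q                      ∎
  where
  open ≤-Reasoning
  d≤e : d ≤ e
  d≤e = ≮⇒≥ (λ e<d → All.lookup least (∈-downFrom⁺ e<d) sum567-e)

depth≤⇒Rep : ∀ {a r d q} → Sum567 (d * a + r) → depth a r d ≤ q → Rep a (q * a + r)
depth≤⇒Rep {a} {r} {d} sum567 D≤q with o , refl ← m≤n⇒∃[o]m+o≡n D≤q =
  rep (c + o) (d * a + r) sum567 (m≤m+n c o) (regroup c o d a r)
  where
  c = ⌈ d * a + r /7⌉
  regroup : ∀ c o d a r → (c + o) * a + (d * a + r) ≡ (d + c + o) * a + r
  regroup = solve-∀

sylvesterNumberIs-∑ : ∀ a {{_ : NonZero a}} (lift : ℕ → ℕ) → (∀ {r} → r < a → IsLift a r (lift r)) →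
  SylvesterNumberIs (generators a) (∑[ r < a ] depth a r (lift r))
sylvesterNumberIs-∑ a lift isLift = Selmer.sylvesterNumberIs (generators a) a
  (λ r → depth a r (lift r))
  (λ r<a q<D rep-n → <⇒≱ q<D (depth≤ (isLift r<a) r<a (representable⇒Rep rep-n)))
  (λ {_} {r} r<a D≤q → Rep⇒representable (depth≤⇒Rep {d = lift r} (proj₁ (isLift r<a)) D≤q))

isLift? : ∀ a r d → Dec (IsLift a r d)
isLift? a r d = sum567? (d * a + r) ×-dec All.all? (λ e → ¬? (sum567? (e * a + r))) (downFrom d)

lifts-by-evaluation : ∀ a (lift : ℕ → ℕ) → True (All.all? (λ r → isLift? a r (lift r)) (downFrom a)) →
  ∀ {r} → r < a → IsLift a r (lift r)
lifts-by-evaluation a lift ok r<a = All.lookup (toWitness ok) (∈-downFrom⁺ r<a)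

lift₅ : ℕ → ℕ
lift₅ 1 = 1
lift₅ 2 = 1
lift₅ 3 = 2
lift₅ 4 = 2
lift₅ _ = 0

lift₆ : ℕ → ℕ
lift₆ 1 = 1
lift₆ 2 = 2
lift₆ 3 = 2
lift₆ 4 = 1
lift₆ _ = 0

lift₇ : ℕ → ℕ
lift₇ 1 = 2
lift₇ 2 = 2
lift₇ 3 = 1
lift₇ 4 = 1
lift₇ _ = 0

-- 1 on the gaps 1, 2, 3, 4, 8, 9 of the semigroup generated by 5, 6, 7, and 0 elsewhere
gap567 : ℕ → ℕ
gap567 r with sum567? r
... | yes _ = 0
... | no _ = 1

gap567-≥10 : ∀ {r} → 10 ≤ r → gap567 r ≡ 0
gap567-≥10 {r} 10≤r with sum567? r
... | yes _ = refl
... | no ¬sum567 = contradiction (sum567-≥10 10≤r) ¬sum567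

isLift-≥10 : ∀ {a} → 10 ≤ a → ∀ r → IsLift a r (gap567 r)
isLift-≥10 {a} 10≤a r with sum567? r
... | yes sum567 = sum567 , All.[]
... | no ¬sum567 = sum567-≥10 {1 * a + r} (≤-trans 10≤a a≤1*a+r) , ¬sum567 All.∷ All.[]
  where
  a≤1*a+r : a ≤ 1 * a + r
  a≤1*a+r = ≤-trans (m≤m+n a r) (≤-reflexive (cong (_+ r) (sym (*-identityˡ a))))

∑gap567 : ∀ j → ∑[ r < 10 + j ] gap567 r ≡ 6
∑gap567 zero = refl
∑gap567 (suc j) = cong₂ _+_ (gap567-≥10 (m≤m+n 10 j)) (∑gap567 j)

depth-≥10 : ∀ a {r} → 10 ≤ r → depth a r (gap567 r) ≡ ⌈ r /7⌉
depth-≥10 a 10≤r rewrite gap567-≥10 10≤r = refl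

depth-+7 : ∀ a r → depth (7 + a) r (gap567 r) ≡ gap567 r + depth a r (gap567 r)
depth-+7 a r with sum567? r
... | yes _ = refl
... | no _ = cong suc (⌈7+n/7⌉ (1 * a + r))

gapCount : ℕ → ℕ
gapCount a = ∑[ r < a ] depth a r (gap567 r)

gapCount-+7 : ∀ j → let a = 10 + j in gapCount (7 + a) ≡ (6 + a) + (6 + gapCount a)
gapCount-+7 j = begin
  gapCount (7 + a)
    ≡⟨ ∑-split a 7 (λ r → depth (7 + a) r (gap567 r)) ⟩
  ∑[ i < 7 ] depth (7 + a) (i + a) (gap567 (i + a)) + ∑[ r < a ] depth (7 + a) r (gap567 r)
    ≡⟨ cong₂ _+_ (∑-cong 7 (λ i → depth-≥10 (7 + a) (≤-trans (m≤m+n 10 j) (m≤n+m a i))))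
                 (∑-cong a (depth-+7 a)) ⟩
  ∑[ i < 7 ] ⌈ i + a /7⌉ + ∑[ r < a ] (gap567 r + depth a r (gap567 r))
    ≡⟨ cong₂ _+_ (∑⌈/7⌉-7 a) (∑-+ a gap567 (λ r → depth a r (gap567 r))) ⟩
  (6 + a) + (∑[ r < a ] gap567 r + gapCount a)
    ≡⟨ cong (λ g → (6 + a) + (g + gapCount a)) (∑gap567 j) ⟩
  (6 + a) + (6 + gapCount a) ∎
  where
  open ≡-Reasoning
  a = 10 + j

square-+7 : ∀ a N c → 14 * N ≡ a * a + 17 * a + c →
  14 * ((6 + a) + (6 + N)) ≡ (7 + a) * (7 + a) + 17 * (7 + a) + c
square-+7 a N c 14N≡ = begin
  14 * ((6 + a) + (6 + N))                ≡⟨ solve (a ∷ N ∷ []) ⟩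
  14 * N + 14 * (12 + a)                  ≡⟨ cong (_+ 14 * (12 + a)) 14N≡ ⟩
  a * a + 17 * a + c + 14 * (12 + a)      ≡⟨ solve (a ∷ c ∷ []) ⟩
  (7 + a) * (7 + a) + 17 * (7 + a) + c    ∎
  where open ≡-Reasoning

14*gapCount : ∀ j → let a = 10 + j in 14 * gapCount a ≡ a * a + 17 * a + const7 (a % 7)
14*gapCount 0 = refl
14*gapCount 1 = refl
14*gapCount 2 = refl
14*gapCount 3 = refl
14*gapCount 4 = refl
14*gapCount 5 = refl
14*gapCount 6 = refl
14*gapCount (suc (suc (suc (suc (suc (suc (suc j))))))) = begin
  14 * gapCount (7 + a)
    ≡⟨ cong (14 *_) (gapCount-+7 j) ⟩
  14 * ((6 + a) + (6 + gapCount a))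
    ≡⟨ square-+7 a _ _ (14*gapCount j) ⟩
  (7 + a) * (7 + a) + 17 * (7 + a) + const7 (a % 7)
    ≡⟨ cong (λ x → (7 + a) * (7 + a) + 17 * (7 + a) + const7 x) (%-remove-+ˡ a (∣-refl {7})) ⟨
  (7 + a) * (7 + a) + 17 * (7 + a) + const7 ((7 + a) % 7) ∎
  where
  open ≡-Reasoning
  a = 10 + j

corollary12 : (a : ℕ) → (a ≡ 5 ⊎ a ≡ 6 ⊎ a ≡ 7 ⊎ 10 ≤ a) →
    ∃ λ N → SylvesterNumberIs (a ∷ (a + 5) ∷ (a + 6) ∷ (a + 7) ∷ []) N
      × (14 * N ≡ a * a + 17 * a + const7 (a % 7))
corollary12 _ (inj₁ refl) = _ , sylvesterNumberIs-∑ 5 lift₅ (lifts-by-evaluation 5 lift₅ _) , refl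
corollary12 _ (inj₂ (inj₁ refl)) = _ , sylvesterNumberIs-∑ 6 lift₆ (lifts-by-evaluation 6 lift₆ _) , refl
corollary12 _ (inj₂ (inj₂ (inj₁ refl))) = _ , sylvesterNumberIs-∑ 7 lift₇ (lifts-by-evaluation 7 lift₇ _) , refl
corollary12 a (inj₂ (inj₂ (inj₂ 10≤a))) with j , refl ← m≤n⇒∃[o]m+o≡n 10≤a =
  _ , sylvesterNumberIs-∑ (10 + j) gap567 (λ {r} _ → isLift-≥10 10≤a r) , 14*gapCount j
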